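{- Let $(X,\theta)$ be a commutation alphabet and $R\subseteq X\times\mathcal{S}(X,\theta)$ such that the alphabetic rewriting system $(\mathcal{S}(X,\theta),\Rightarrow_R)$ is convergent. Then the normal form map $\mathcal{N}\colon\mathcal{S}(X,\theta)\to\mathsf{Irr}(\mathcal{S}(X,\theta),\Rightarrow_R)$ is a surjective homomorphism of semigroups.
   Context: A commutation alphabet is a pair $(X,\theta)$ with $\theta\subseteq X\times X$ symmetric and irreflexive. $\mathcal{S}(X,\theta)=X^+/\equiv_\theta$, $\mathcal{M}(X,\theta)=X^*/\equiv_\theta$, where $\equiv_\theta$ is the congruence generated by $(xy,yx)$, $(x,y)\in\theta$; $X$ is identified with its image in $\mathcal{S}(X,\theta)$. $w\Rightarrow_R w'$ iff $w=uav$, $w'=ubv$ for some $u,v\in\mathcal{M}(X,\theta)$, $(a,b)\in R$. Convergent means terminating (no infinite $\Rightarrow_R$-chain) and confluent. Irreducible elements are those with no $\Rightarrow_R$-successor; $\mathsf{Irr}(\mathcal{S}(X,\theta),\Rightarrow_R)$ is their set (a sub-semigroup). By convergence every $w$ has a unique irreducible $\mathcal{N}(w)$ with $w\xRightarrow{*}\mathcal{N}(w)$, $\xRightarrow{*}$ being the reflexive transitive closure of $\Rightarrow_R$. -}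

module Defs where

open import Level using (Level; _⊔_; suc)
open import Data.Nat using (ℕ)
open import Data.List using (List; []; _∷_; _++_; [_])
open import Data.List.NonEmpty using (List⁺; toList; _⁺++⁺_)
open import Data.Product using (Σ; ∃; _×_; _,_)
open import Relation.Nullary using (¬_)
open import Relation.Binary.PropositionalEquality using (_≡_)

record CommutationAlphabet (a ℓ : Level) : Set (Level.suc (a ⊔ ℓ)) where
  field
    X      : Set a
    θ      : X → X → Set ℓ
    θ-sym  : ∀ {x y} → θ x y → θ y x
    θ-irr  : ∀ {x} → ¬ θ x x

module Traces {a ℓ : Level} (A : CommutationAlphabet a ℓ) where
  open CommutationAlphabet A

  -- ≡θ : the congruence on X* generated by (xy, yx), (x,y) ∈ θ.
  -- Elements of M(X,θ) are represented by words; equality in M is _≡θ_.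
  data _≡θ_ : List X → List X → Set (a ⊔ ℓ) where
    θ-refl  : ∀ {w} → w ≡θ w
    θ-symm  : ∀ {w w'} → w ≡θ w' → w' ≡θ w
    θ-trans : ∀ {w w' w''} → w ≡θ w' → w' ≡θ w'' → w ≡θ w''
    θ-swap  : ∀ u v {x y} → θ x y → (u ++ x ∷ y ∷ v) ≡θ (u ++ y ∷ x ∷ v)

  -- S(X,θ) = X⁺/≡θ : represented by non-empty words, with equality _≈_.
  S : Set a
  S = List⁺ X

  _≈_ : S → S → Set (a ⊔ ℓ)
  w ≈ w' = toList w ≡θ toList w'

  _·_ : S → S → S
  _·_ = _⁺++⁺_

  module Rewriting {r : Level} (R : X → S → Set r) where
    _⇒_ : S → S → Set (a ⊔ ℓ ⊔ r)
    w ⇒ w' = Σ (List X) λ u → Σ (List X) λ v → Σ X λ x → Σ S λ b →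
               R x b × (toList w ≡θ (u ++ [ x ] ++ v))
                     × (toList w' ≡θ (u ++ toList b ++ v))

    data _⇒*_ : S → S → Set (a ⊔ ℓ ⊔ r) where
      done : ∀ {w w'} → w ≈ w' → w ⇒* w'
      step : ∀ {w w₁ w'} → w ⇒ w₁ → w₁ ⇒* w' → w ⇒* w'

    Terminating : Set (a ⊔ ℓ ⊔ r)
    Terminating = ¬ (Σ (ℕ → S) λ f → ∀ n → f n ⇒ f (ℕ.suc n))

    Confluent : Set (a ⊔ ℓ ⊔ r)
    Confluent = ∀ {w w₁ w₂} → w ⇒* w₁ → w ⇒* w₂ →
                Σ S λ w₃ → (w₁ ⇒* w₃) × (w₂ ⇒* w₃)

    Convergent : Set (a ⊔ ℓ ⊔ r)
    Convergent = Terminating × Confluent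

    Irreducible : S → Set (a ⊔ ℓ ⊔ r)
    Irreducible w = ∀ w' → ¬ (w ⇒ w')

    IsNormalFormMap : (S → S) → Set (a ⊔ ℓ ⊔ r)
    IsNormalFormMap N = ∀ w → Irreducible (N w) × (w ⇒* N w)

module Submission where

-- Structure of the argument.
--  * Trace equivalence ≡θ is a congruence for concatenation, and traces
--    are permutations of each other, so a letterwise property of a word is
--    an invariant of its trace.
--  * One-step rewriting respects ≈ and is compatible with multiplication on
--    both sides; hence so is its reflexive-transitive closure ⇒*.
--  * Because every rule has a single letter as its left-hand side, a trace
--    is irreducible iff each of its letters is terminal (the left side of no
--    rule).  Consequently the irreducible elements form a sub-semigroup.
--  * By confluence, two irreducible descendants of one element are equal.
--    Applying this to N v and N w for v ≈ w, to N (v·w) and N v · N w, and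
--    to N w and w for irreducible w gives well-definedness, the
--    homomorphism property and surjectivity.

open import Level using (Level)
open import Data.Product using (Σ; _×_; _,_; proj₁; proj₂)
open import Data.List using (List; []; _∷_; _++_)
open import Data.List.NonEmpty using (toList) renaming (_∷_ to _∷⁺_)
open import Data.List.Properties using (++-assoc)
open import Data.List.Relation.Unary.All using (All; _∷_; tabulate)
open import Data.List.Relation.Unary.All.Properties using (++⁺; ++⁻ʳ)
open import Data.List.Membership.Propositional using (_∈_)
open import Data.List.Membership.Propositional.Properties using (∈-∃++)
open import Data.List.Relation.Binary.Permutation.Propositional
  using (_↭_; ↭-refl; ↭-sym; ↭-trans; swap)
open import Data.List.Relation.Binary.Permutation.Propositional.Properties
  using (All-resp-↭; ++⁺ˡ)
open import Relation.Binary.PropositionalEquality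
  using (_≡_; refl; sym; trans; cong)
open import Relation.Nullary using (¬_)
open import Data.Empty using (⊥-elim)
open import Defs

module _ {a ℓ : Level} (A : CommutationAlphabet a ℓ) where
  open CommutationAlphabet A
  open Traces A

  ≡⇒≡θ : ∀ {p q} → p ≡ q → p ≡θ q
  ≡⇒≡θ refl = θ-refl

  ≡θ-++ʳ : ∀ {p q} t → p ≡θ q → (p ++ t) ≡θ (q ++ t)
  ≡θ-++ʳ t θ-refl        = θ-refl
  ≡θ-++ʳ t (θ-symm e)    = θ-symm (≡θ-++ʳ t e)
  ≡θ-++ʳ t (θ-trans e f) = θ-trans (≡θ-++ʳ t e) (≡θ-++ʳ t f)
  ≡θ-++ʳ t (θ-swap u v {x} {y} xθy) =
    θ-trans (≡⇒≡θ (++-assoc u (x ∷ y ∷ v) t))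
      (θ-trans (θ-swap u (v ++ t) xθy) (≡⇒≡θ (sym (++-assoc u (y ∷ x ∷ v) t))))

  ≡θ-++ˡ : ∀ {p q} t → p ≡θ q → (t ++ p) ≡θ (t ++ q)
  ≡θ-++ˡ t θ-refl        = θ-refl
  ≡θ-++ˡ t (θ-symm e)    = θ-symm (≡θ-++ˡ t e)
  ≡θ-++ˡ t (θ-trans e f) = θ-trans (≡θ-++ˡ t e) (≡θ-++ˡ t f)
  ≡θ-++ˡ t (θ-swap u v {x} {y} xθy) =
    θ-trans (≡⇒≡θ (sym (++-assoc t u (x ∷ y ∷ v))))
      (θ-trans (θ-swap (t ++ u) v xθy) (≡⇒≡θ (++-assoc t u (y ∷ x ∷ v))))

  ≡θ⇒↭ : ∀ {p q} → p ≡θ q → p ↭ q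
  ≡θ⇒↭ θ-refl                 = ↭-refl
  ≡θ⇒↭ (θ-symm e)             = ↭-sym (≡θ⇒↭ e)
  ≡θ⇒↭ (θ-trans e f)          = ↭-trans (≡θ⇒↭ e) (≡θ⇒↭ f)
  ≡θ⇒↭ (θ-swap u v {x} {y} _) = ++⁺ˡ u (swap x y ↭-refl)

  module _ {r : Level} (R : X → S → Set r) where
    open Rewriting R

    ⇒-respˡ : ∀ {v v' w} → v ≈ v' → v' ⇒ w → v ⇒ w
    ⇒-respˡ v≈v' (u , t , x , b , rule , src , tgt) =
      u , t , x , b , rule , θ-trans v≈v' src , tgt

    ⇒*-respˡ : ∀ {v v' w} → v ≈ v' → v' ⇒* w → v ⇒* w
    ⇒*-respˡ v≈v' (done e)      = done (θ-trans v≈v' e)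
    ⇒*-respˡ v≈v' (step s rest) = step (⇒-respˡ v≈v' s) rest

    ⇒*-trans : ∀ {u v w} → u ⇒* v → v ⇒* w → u ⇒* w
    ⇒*-trans (done e)   q = ⇒*-respˡ e q
    ⇒*-trans (step s p) q = step s (⇒*-trans p q)

    ⇒-·ʳ : ∀ {v v'} w → v ⇒ v' → (v · w) ⇒ (v' · w)
    ⇒-·ʳ w (u , t , x , b , rule , src , tgt) =
      u , t ++ toList w , x , b , rule ,
      θ-trans (≡θ-++ʳ (toList w) src) (≡⇒≡θ (++-assoc u (x ∷ t) (toList w))) ,
      θ-trans (≡θ-++ʳ (toList w) tgt) (≡⇒≡θ (reassoc u (toList b) t (toList w)))
      where
      reassoc : (u b t w : List X) → (u ++ b ++ t) ++ w ≡ u ++ b ++ t ++ w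
      reassoc u b t w = trans (++-assoc u (b ++ t) w) (cong (u ++_) (++-assoc b t w))

    ⇒-·ˡ : ∀ v {w w'} → w ⇒ w' → (v · w) ⇒ (v · w')
    ⇒-·ˡ v (u , t , x , b , rule , src , tgt) =
      toList v ++ u , t , x , b , rule ,
      θ-trans (≡θ-++ˡ (toList v) src) (≡⇒≡θ (sym (++-assoc (toList v) u (x ∷ t)))) ,
      θ-trans (≡θ-++ˡ (toList v) tgt) (≡⇒≡θ (sym (++-assoc (toList v) u (toList b ++ t))))

    ⇒*-·ʳ : ∀ {v v'} w → v ⇒* v' → (v · w) ⇒* (v' · w)
    ⇒*-·ʳ w (done e)   = done (≡θ-++ʳ (toList w) e)
    ⇒*-·ʳ w (step s p) = step (⇒-·ʳ w s) (⇒*-·ʳ w p)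

    ⇒*-·ˡ : ∀ v {w w'} → w ⇒* w' → (v · w) ⇒* (v · w')
    ⇒*-·ˡ v (done e)   = done (≡θ-++ˡ (toList v) e)
    ⇒*-·ˡ v (step s p) = step (⇒-·ˡ v s) (⇒*-·ˡ v p)

    ⇒*-· : ∀ {v v' w w'} → v ⇒* v' → w ⇒* w' → (v · w) ⇒* (v' · w')
    ⇒*-· {v' = v'} {w = w} p q = ⇒*-trans (⇒*-·ʳ w p) (⇒*-·ˡ v' q)

    irreducible-⇒* : ∀ {w w'} → Irreducible w → w ⇒* w' → w ≈ w'
    irreducible-⇒* irr (done e)             = e
    irreducible-⇒* irr (step {w₁ = w₁} s _) = ⊥-elim (irr w₁ s)

    Terminal : X → Set _
    Terminal x = ∀ b → ¬ R x b

    splice : List X → S → List X → S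
    splice []      (b ∷⁺ bs) t = b ∷⁺ (bs ++ t)
    splice (c ∷ u) (b ∷⁺ bs) t = c ∷⁺ (u ++ b ∷ bs ++ t)

    splice-toList : ∀ u b t → toList (splice u b t) ≡ u ++ toList b ++ t
    splice-toList []      (b ∷⁺ bs) t = refl
    splice-toList (c ∷ u) (b ∷⁺ bs) t = refl

    -- A trace all of whose letters are terminal is irreducible: the letter
    -- rewritten by a step would occur in it, by permutation invariance.
    terminal⇒irreducible : ∀ w → All Terminal (toList w) → Irreducible w
    terminal⇒irreducible w allT w' (u , t , x , b , rule , src , _)
      with ++⁻ʳ u (All-resp-↭ (≡θ⇒↭ src) allT)
    ... | x-terminal ∷ _ = x-terminal b rule

    -- Conversely, every letter x of an irreducible trace u x t is terminal,
    -- since a rule (x , b) would give the step u x t ⇒ u b t.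
    irreducible⇒terminal : ∀ w → Irreducible w → All Terminal (toList w)
    irreducible⇒terminal w irr = tabulate terminal
      where
      terminal : ∀ {x} → x ∈ toList w → Terminal x
      terminal {x} x∈w b rule with ∈-∃++ x∈w
      ... | u , t , w≡uxt =
        irr (splice u b t)
            (u , t , x , b , rule , ≡⇒≡θ w≡uxt , ≡⇒≡θ (splice-toList u b t))

    irreducible-· : ∀ v w → Irreducible v → Irreducible w → Irreducible (v · w)
    irreducible-· v w irr-v irr-w =
      terminal⇒irreducible (v · w)
        (++⁺ (irreducible⇒terminal v irr-v) (irreducible⇒terminal w irr-w))

    unique-irreducible : Confluent → ∀ {w v₁ v₂} →
      Irreducible v₁ → Irreducible v₂ → w ⇒* v₁ → w ⇒* v₂ → v₁ ≈ v₂
    unique-irreducible confluent irr₁ irr₂ p₁ p₂ with confluent p₁ p₂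
    ... | _ , q₁ , q₂ =
      θ-trans (irreducible-⇒* irr₁ q₁) (θ-symm (irreducible-⇒* irr₂ q₂))

    module _ (confluent : Confluent) (N : S → S) (isNF : IsNormalFormMap N) where

      N-resp-≈ : ∀ v w → v ≈ w → N v ≈ N w
      N-resp-≈ v w v≈w =
        unique-irreducible confluent (proj₁ (isNF v)) (proj₁ (isNF w))
          (proj₂ (isNF v)) (⇒*-respˡ v≈w (proj₂ (isNF w)))

      -- N (v w) and N v · N w are irreducible descendants of v w.
      N-homomorphism : ∀ v w → N (v · w) ≈ (N v · N w)
      N-homomorphism v w =
        unique-irreducible confluent (proj₁ (isNF (v · w)))
          (irreducible-· (N v) (N w) (proj₁ (isNF v)) (proj₁ (isNF w)))
          (proj₂ (isNF (v · w))) (⇒*-· (proj₂ (isNF v)) (proj₂ (isNF w)))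

      N-surjective : ∀ w → Irreducible w → Σ S λ v → N v ≈ w
      N-surjective w irr = w , θ-symm (irreducible-⇒* irr (proj₂ (isNF w)))

mainTheorem7 : ∀ {a ℓ r : Level} (A : CommutationAlphabet a ℓ)
    → let open CommutationAlphabet A
          open Traces A
      in (R : X → S → Set r)
    → let open Rewriting R
      in Convergent
    → (N : S → S) → IsNormalFormMap N
    → ((∀ v w → v ≈ w → N v ≈ N w)
       × (∀ v w → N (v · w) ≈ (N v · N w))
       × (∀ w → Irreducible w → Σ S λ v → N v ≈ w))
mainTheorem7 A R (_ , confluent) N isNF =
  N-resp-≈ A R confluent N isNF ,
  N-homomorphism A R confluent N isNF ,
  N-surjective A R confluent N isNF
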